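{- Let $G$ be a finite simple connected graph that has at least one perfect matching, and let $\pi$ be any ordering of its vertices. Run the following procedure: set $B=\emptyset$, $G_1=G$, $i=1$; while $G_i$ is nonempty, let $v_i$ be the vertex of $G_i$ appearing earliest in $\pi$, add to $B$ all edges of $G_i$ incident to $v_i$, let $G_{i+1}$ be the induced subgraph of $G_i$ obtained by deleting $v_i$ and all its neighbors in $G_i$, and increase $i$ by one. Then the set $S=E(G)\setminus B$ is a complete forcing set of $G$.
   Context: A perfect matching of $G$ is a set of pairwise disjoint edges covering every vertex. For a perfect matching $M$, a subset $S\subseteq M$ is a forcing set of $M$ if $M$ is the unique perfect matching of $G$ containing $S$. A subset $S\subseteq E(G)$ is a complete forcing set of $G$ if for every perfect matching $M$ of $G$, the set $S\cap M$ is a forcing set of $M$. -}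

module Defs where

open import Data.Nat using (ℕ)
open import Data.Fin using (Fin; _≟_)
open import Data.Bool using (Bool; true; false; _∧_; _∨_; not; if_then_else_)
open import Data.List using (List; []; _∷_; tabulate)
open import Data.Product using (Σ; _×_; _,_)
open import Relation.Binary.PropositionalEquality using (_≡_; _≢_)
open import Relation.Nullary.Decidable using (⌊_⌋)
open import Function.Bundles using (_⤖_; Bijection)

record Graph (n : ℕ) : Set where
  field
    adj   : Fin n → Fin n → Bool
    sym   : ∀ x y → adj x y ≡ adj y x
    irrefl : ∀ x → adj x x ≡ false
open Graph public

data Reach {n : ℕ} (G : Graph n) : Fin n → Fin n → Set where
  here : ∀ {x} → Reach G x x
  step : ∀ {x y z} → adj G x y ≡ true → Reach G y z → Reach G x z

Connected : {n : ℕ} → Graph n → Set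
Connected G = ∀ x y → Reach G x y

-- A set of edges is a symmetric Boolean predicate on ordered vertex pairs;
-- the edge {x,y} (with adj x y) belongs to S iff S x y ≡ true.
EdgeSet : ℕ → Set
EdgeSet n = Fin n → Fin n → Bool

-- A perfect matching M is represented by its partner function m:
-- M = { {x , m x} : x ∈ V }, where m is a fixed-point-free involution along edges.
record PerfectMatching {n : ℕ} (G : Graph n) : Set where
  field
    mate     : Fin n → Fin n
    mate-adj : ∀ x → adj G x (mate x) ≡ true
    mate-inv : ∀ x → mate (mate x) ≡ x
open PerfectMatching public

InM : {n : ℕ} {G : Graph n} → PerfectMatching G → Fin n → Fin n → Set
InM M x y = mate M x ≡ y

-- S ∩ M is a forcing set of M: M is the unique perfect matching containing S ∩ M.
IsForcingOf : {n : ℕ} {G : Graph n} → EdgeSet n → PerfectMatching G → Set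
IsForcingOf {G = G} S M =
  (M' : PerfectMatching G) →
  (∀ x → S x (mate M x) ≡ true → InM M' x (mate M x)) →
  ∀ x → mate M' x ≡ mate M x

IsCompleteForcing : {n : ℕ} (G : Graph n) → EdgeSet n → Set
IsCompleteForcing G S = (M : PerfectMatching G) → IsForcingOf S M

-- State: the set of deleted vertices (V(G) ∖ V(G_i)) and the edge set B.
-- Scanning the vertices in the order π, the next vertex that is not yet deleted is
-- exactly the earliest vertex of G_i in π; it becomes v_i.
record State (n : ℕ) : Set where
  constructor st
  field
    deleted : Fin n → Bool
    Bset    : EdgeSet n

eqb : {n : ℕ} → Fin n → Fin n → Bool
eqb x y = ⌊ x ≟ y ⌋

procStep : {n : ℕ} → Graph n → State n → Fin n → State n
procStep G (st del B) v =
  if del v then st del B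
  else st (λ w → del w ∨ eqb w v ∨ adj G v w)
          (λ x y → B x y ∨
             (adj G x y ∧ ((eqb x v ∧ not (del y)) ∨ (eqb y v ∧ not (del x)))))

runProc : {n : ℕ} → Graph n → State n → List (Fin n) → State n
runProc G s [] = s
runProc G s (v ∷ vs) = runProc G (procStep G s v) vs

orderList : {n : ℕ} → (Fin n ⤖ Fin n) → List (Fin n)
orderList π = tabulate (Bijection.to π)

procB : {n : ℕ} → Graph n → (Fin n ⤖ Fin n) → EdgeSet n
procB G π = State.Bset (runProc G (st (λ _ → false) (λ _ _ → false)) (orderList π))

procS : {n : ℕ} → Graph n → (Fin n ⤖ Fin n) → EdgeSet n
procS G π x y = adj G x y ∧ not (procB G π x y)

{-# OPTIONS --safe #-}
module Submission where

-- Suppose a perfect matching M' contains S ∩ M but differs from M, and call a vertex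
-- disagreeing if M and M' pair it differently.  The M-edge at a disagreeing vertex is
-- not in M', hence not in S, hence in B.  Look at the first step at which the procedure
-- touches a disagreeing vertex, by deleting it or by putting its M-edge into B.  Edges
-- of B at a vertex never change once the vertex is deleted, and the edges added at
-- step i all contain v_i, so v_i is itself disagreeing.  But then its M'-partner is a
-- disagreeing neighbour of v_i, deleted at step i, whose M-edge does not contain v_i;
-- that edge never enters B.

open import Defs hiding (sym)
open import Data.Bool using (true; false; _∧_; not)
open import Data.Bool.Properties using (∨-zeroʳ; ∨-identityʳ; ∧-zeroʳ; ¬-not; not-¬)
open import Data.Fin using (Fin; _≟_)
open import Data.List using (List; []; _∷_)
open import Data.Nat using (ℕ)
open import Data.Product using (_×_; _,_; proj₁; proj₂)
open import Data.Sum using (_⊎_; inj₁; inj₂)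
open import Function using (_∘_)
open import Function.Bundles using (_⤖_)
open import Relation.Binary.PropositionalEquality
  using (_≡_; _≢_; refl; sym; trans; cong; ≢-sym; module ≡-Reasoning)
open import Relation.Nullary using (¬_; yes; no; contradiction)
open import Relation.Nullary.Decidable using (decidable-stable)

open State

∧-not-true : ∀ {a} b → a ≡ true → a ∧ not b ≢ true → b ≡ true
∧-not-true true  _    _ = refl
∧-not-true false refl h = contradiction refl h

module _ {n : ℕ} {G : Graph n} where

  mate-≢ : (M : PerfectMatching G) (x : Fin n) → mate M x ≢ x
  mate-≢ M x e = not-¬ (mate-adj M x) (trans (cong (adj G x) e) (irrefl G x))

  mate-disagree : (M M' : PerfectMatching G) {x : Fin n} →
                  mate M' x ≢ mate M x → mate M' (mate M x) ≢ mate M (mate M x)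
  mate-disagree M M' {x} dx e = dx (begin
      mate M' x                      ≡⟨ cong (mate M') (sym (trans e (mate-inv M x))) ⟩
      mate M' (mate M' (mate M x))   ≡⟨ mate-inv M' (mate M x) ⟩
      mate M x                       ∎)
    where open ≡-Reasoning

module _ {n : ℕ} (G : Graph n) where

  procStep-keeps-deleted : ∀ s v {x} → deleted s x ≡ true → deleted (procStep G s v) x ≡ true
  procStep-keeps-deleted s v d with deleted s v
  ... | true  = d
  ... | false rewrite d = refl

  procStep-deletes-neighbour : ∀ s {v x} → deleted s v ≡ false → adj G v x ≡ true →
                               deleted (procStep G s v) x ≡ true
  procStep-deletes-neighbour s {v} {x} live a rewrite live | a with deleted s x
  ... | true  = refl
  ... | false = ∨-zeroʳ (eqb x v)

  procStep-frozen : ∀ s v {x} y → deleted s x ≡ true → Bset (procStep G s v) x y ≡ Bset s x y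
  procStep-frozen s v {x} y d with deleted s v in live
  ... | true  = refl
  ... | false rewrite d with x ≟ v
  ...   | yes refl = contradiction live (not-¬ d)
  ...   | no _ rewrite ∧-zeroʳ (eqb y v) | ∧-zeroʳ (adj G x y) = ∨-identityʳ (Bset s x y)

  runProc-frozen : ∀ vs s {x} y → deleted s x ≡ true → Bset (runProc G s vs) x y ≡ Bset s x y
  runProc-frozen []       s y d = refl
  runProc-frozen (v ∷ vs) s y d =
    trans (runProc-frozen vs (procStep G s v) y (procStep-keeps-deleted s v d))
          (procStep-frozen s v y d)

  procStep-new-edge : ∀ s v {x y} → Bset s x y ≡ false → Bset (procStep G s v) x y ≡ true →
                      x ≡ v ⊎ y ≡ v
  procStep-new-edge s v {x} {y} old new with deleted s v
  ... | true  = contradiction new (not-¬ old)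
  ... | false rewrite old with x ≟ v | y ≟ v
  ...   | yes x≡v | _       = inj₁ x≡v
  ...   | no _    | yes y≡v = inj₂ y≡v
  ...   | no _    | no _    = contradiction new (not-¬ (∧-zeroʳ (adj G x y)))

module Disagreement {n : ℕ} {G : Graph n} (M M' : PerfectMatching G) where

  Disagree : Fin n → Set
  Disagree x = mate M' x ≢ mate M x

  disagree-mate : ∀ {x} → Disagree x → Disagree (mate M x)
  disagree-mate = mate-disagree M M'

  disagree-mate' : ∀ {x} → Disagree x → Disagree (mate M' x)
  disagree-mate' dx = ≢-sym (mate-disagree M' M (≢-sym dx))

  Untouched : State n → Set
  Untouched s = (∀ x → Disagree x → deleted s x ≡ false)
              × (∀ x → Disagree x → Bset s x (mate M x) ≡ false)

  Covering : List (Fin n) → State n → Set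
  Covering vs s = ∀ x → Disagree x → Bset (runProc G s vs) x (mate M x) ≡ true

  module _ (s : State n) (v : Fin n) (vs : List (Fin n))
           (untouched : Untouched s) (covering : Covering vs (procStep G s v)) where

    touched-at-chosen : ∀ {x} → Disagree x → Bset (procStep G s v) x (mate M x) ≡ true →
                        x ≡ v ⊎ mate M x ≡ v
    touched-at-chosen {x} dx = procStep-new-edge G s v (proj₂ untouched x dx)

    deleted-at-chosen : ∀ {x} → Disagree x → deleted (procStep G s v) x ≡ true →
                        x ≡ v ⊎ mate M x ≡ v
    deleted-at-chosen {x} dx d =
      touched-at-chosen dx (trans (sym (runProc-frozen G vs _ _ d)) (covering x dx))

    chosen-agrees : ¬ Disagree v
    chosen-agrees dv with deleted-at-chosen (disagree-mate' dv)
      (procStep-deletes-neighbour G s (proj₁ untouched v dv) (mate-adj M' v))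
    ... | inj₁ m'v≡v  = mate-≢ M' v m'v≡v
    ... | inj₂ mm'v≡v = dv (trans (sym (mate-inv M (mate M' v))) (cong (mate M) mm'v≡v))

    disagree-chosen : ∀ {x} → Disagree x → x ≡ v ⊎ mate M x ≡ v → Disagree v
    disagree-chosen dx (inj₁ refl) = dx
    disagree-chosen dx (inj₂ refl) = disagree-mate dx

    untouched-step : Untouched (procStep G s v)
    untouched-step =
        (λ x dx → ¬-not λ d → chosen-agrees (disagree-chosen dx (deleted-at-chosen dx d)))
      , (λ x dx → ¬-not λ b → chosen-agrees (disagree-chosen dx (touched-at-chosen dx b)))

  covering-forces-agreement : ∀ vs s → Untouched s → Covering vs s → ∀ x → ¬ Disagree x
  covering-forces-agreement []       s untouched covering x dx =
    not-¬ (covering x dx) (proj₂ untouched x dx)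
  covering-forces-agreement (v ∷ vs) s untouched covering =
    covering-forces-agreement vs (procStep G s v) (untouched-step s v vs untouched covering)
                              covering

lemma1 : (n : ℕ) (G : Graph n) → Connected G → PerfectMatching G →
    (π : Fin n ⤖ Fin n) → IsCompleteForcing G (procS G π)
lemma1 n G _ _ π M M' S∩M⊆M' x =
  decidable-stable (mate M' x ≟ mate M x)
    (covering-forces-agreement (orderList π) initial initial-untouched disagreement-in-B x)
  where
    open Disagreement M M'

    initial : State n
    initial = st (λ _ → false) (λ _ _ → false)

    initial-untouched : Untouched initial
    initial-untouched = (λ _ _ → refl) , (λ _ _ → refl)

    disagreement-in-B : Covering (orderList π) initial
    disagreement-in-B y dy =
      ∧-not-true (procB G π y (mate M y)) (mate-adj M y) (dy ∘ S∩M⊆M' y)
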